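{- For every integer $d\ge1$, let $L_d^{\mathrm{trap}}=\{w\in\{0,1\}^*\mid |w|_0=|w|_1=2d,\ (\exists i\in\{1,\dots,d\}:\ \delta_{i,i}^{2d}(w)\in\{0101,1010,0110,1001\})\ \text{or}\ (\exists i\in\{1,\dots,d-1\}:\ \delta_{i,i}^{2d\to4}(w)\in\{00111100,11000011\})\}$. Then $L_d^{\mathrm{trap}}$ is $2d$-uniform and $\mathcal{G}_{L_d^{\mathrm{trap}}}$ is exactly the class of $d$-trapezoid graphs.
   Context: $|w|_a$ is the number of occurrences of letter $a$ in $w$; a binary word is $k$-uniform if it has exactly $k$ occurrences of $0$ and of $1$. For a $2d$-uniform binary word $w$: $\delta_{i,i}^{2d}(w)$ keeps only the $(2i-1)$-st and $2i$-th occurrences of $0$ and of $1$ (deleting all other letters), and $\delta_{i,i}^{2d\to4}(w)$ keeps only the $(2i-1)$-st through $(2i+2)$-nd occurrences of $0$ and of $1$. For a word $w$ and distinct letters $a,b$, $h_{a,b}(w)$ replaces $a$ by $0$, $b$ by $1$ and deletes other letters. For $L\subseteq\{0,1\}^*$ closed under exchanging $0$ and $1$ and a word $w$ with letter set $V$, $G(L,w)$ is the graph on $V$ where distinct $u,v$ are adjacent iff $h_{u,v}(w)\in L$; $\mathcal{G}_L$ is the class of graphs isomorphic to some $G(L,w)$. A $d$-trapezoid graph is the intersection graph of $d$-trapezoids between $d$ fixed parallel lines $L_1,\dots,L_d$ (in this order): a $d$-trapezoid is given by intervals $[\ell_i,r_i]$ on $L_i$ ($i=1,\dots,d$) and is the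 region bounded by the polygon connecting $\ell_i$ to $\ell_{i+1}$ for $i<d$, $\ell_d$ to $r_d$, $r_{i+1}$ to $r_i$ for $i<d$, and $r_1$ to $\ell_1$.
   Formalization: The interval endpoints $\ell_i$ and $r_i$ of the d-trapezoids are rational, and the lines $L_1,\dots,L_d$ and their points are taken in the rational plane. -}

module Defs where

open import Data.Bool using (Bool; true; false; if_then_else_)
open import Data.Nat as ℕ using (ℕ; zero; suc; _≤ᵇ_; _∸_)
open import Data.Integer using (+_)
open import Data.Fin as Fin using (Fin; toℕ)
open import Data.List using (List; []; _∷_)
open import Data.List.Membership.Propositional using (_∈_)
open import Data.Product using (Σ; ∃; ∃-syntax; _×_; _,_)
open import Data.Sum using (_⊎_)
open import Relation.Nullary using (¬_; yes; no)
open import Relation.Binary.PropositionalEquality using (_≡_; _≢_)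
open import Function.Bundles using (_⇔_; _↔_; Inverse)
open import Data.Rational as ℚ using (ℚ; _+_; _*_; _-_; _≤_; 0ℚ; 1ℚ)

-- Binary words: letter 0 is false, letter 1 is true.

BWord : Set
BWord = List Bool

count : Bool → BWord → ℕ
count b [] = 0
count true  (true  ∷ w) = suc (count true w)
count true  (false ∷ w) = count true w
count false (false ∷ w) = suc (count false w)
count false (true  ∷ w) = count false w

Uniform : ℕ → BWord → Set
Uniform k w = (count false w ≡ k) × (count true w ≡ k)

-- keepOcc a b w keeps exactly the a-th through b-th occurrences (1-based)
-- of 0 and of 1 in w, deleting all other letters.
-- The auxiliary counters c0, c1 count occurrences of 0, 1 seen so far.
keepOccFrom : ℕ → ℕ → ℕ → ℕ → BWord → BWord
keepOccFrom a b c0 c1 [] = []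
keepOccFrom a b c0 c1 (false ∷ w) =
  if (a ≤ᵇ suc c0) Data.Bool.∧ (suc c0 ≤ᵇ b)
    then false ∷ keepOccFrom a b (suc c0) c1 w
    else keepOccFrom a b (suc c0) c1 w
keepOccFrom a b c0 c1 (true ∷ w) =
  if (a ≤ᵇ suc c1) Data.Bool.∧ (suc c1 ≤ᵇ b)
    then true ∷ keepOccFrom a b c0 (suc c1) w
    else keepOccFrom a b c0 (suc c1) w

keepOcc : ℕ → ℕ → BWord → BWord
keepOcc a b = keepOccFrom a b 0 0

-- δ^{2d}_{i,i}: keep the (2i-1)-st and 2i-th occurrences of 0 and of 1.
-- (Its definition does not depend on d beyond the domain of words.)
δ : ℕ → BWord → BWord
δ i = keepOcc (2 ℕ.* i ∸ 1) (2 ℕ.* i)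

δ4 : ℕ → BWord → BWord
δ4 i = keepOcc (2 ℕ.* i ∸ 1) (2 ℕ.* i ℕ.+ 2)

private
  O I : Bool
  O = false
  I = true

patterns2 : List BWord
patterns2 = (O ∷ I ∷ O ∷ I ∷ []) ∷ (I ∷ O ∷ I ∷ O ∷ []) ∷
            (O ∷ I ∷ I ∷ O ∷ []) ∷ (I ∷ O ∷ O ∷ I ∷ []) ∷ []

patterns4 : List BWord
patterns4 = (O ∷ O ∷ I ∷ I ∷ I ∷ I ∷ O ∷ O ∷ []) ∷
            (I ∷ I ∷ O ∷ O ∷ O ∷ O ∷ I ∷ I ∷ []) ∷ []

Ltrap : ℕ → BWord → Set
Ltrap d w =
  Uniform (2 ℕ.* d) w ×
  ( (∃[ i ] (1 ℕ.≤ i × i ℕ.≤ d × δ i w ∈ patterns2))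
  ⊎ (∃[ i ] (1 ℕ.≤ i × i ℕ.≤ d ∸ 1 × δ4 i w ∈ patterns4)) )

h : {n : ℕ} → Fin n → Fin n → List (Fin n) → BWord
h u v [] = []
h u v (x ∷ w) with x Fin.≟ u | x Fin.≟ v
... | yes _ | _     = false ∷ h u v w
... | no _  | yes _ = true ∷ h u v w
... | no _  | no _  = h u v w

GL : {n : ℕ} → (BWord → Set) → List (Fin n) → Fin n → Fin n → Set
GL L w u v = (u ≢ v) × L (h u v w)

SimpleGraph : {n : ℕ} → (Fin n → Fin n → Set) → Set
SimpleGraph {n} E = (∀ u v → E u v → E v u) × (∀ u → ¬ E u u)

Isomorphic : {n m : ℕ} → (Fin n → Fin n → Set) → (Fin m → Fin m → Set) → Set
Isomorphic {n} {m} E F =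
  Σ (Fin n ↔ Fin m) λ σ → ∀ u v → E u v ⇔ F (Inverse.to σ u) (Inverse.to σ v)

InClassGL : {n : ℕ} → (BWord → Set) → (Fin n → Fin n → Set) → Set
InClassGL L E =
  ∃[ m ] Σ (List (Fin m)) λ w → (∀ (a : Fin m) → a ∈ w) × Isomorphic E (GL L w)

-- d-trapezoids.  Line L_i (i = 1..d, indexed by k : Fin d with i = k+1) is
-- the horizontal line y = toℕ k in the rational plane ℚ × ℚ.

ℕtoℚ : ℕ → ℚ
ℕtoℚ n = + n ℚ./ 1

record Trapezoid (d : ℕ) : Set where
  field
    ℓ r : Fin d → ℚ
    ℓ≤r : ∀ k → ℓ k ≤ r k

-- Closed region bounded by the polygon ℓ_1 … ℓ_d r_d … r_1.
InTrap : {d : ℕ} → Trapezoid d → ℚ × ℚ → Set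
InTrap {d} T (x , y) =
  (∃[ k ] (y ≡ ℕtoℚ (toℕ k) × ℓ k ≤ x × x ≤ r k))
  ⊎ (∃[ k ] ∃[ k' ] ∃[ t ]
       ( toℕ k' ≡ suc (toℕ k) × 0ℚ ≤ t × t ≤ 1ℚ
       × y ≡ ℕtoℚ (toℕ k) + t
       × ((1ℚ - t) * ℓ k + t * ℓ k') ≤ x
       × x ≤ ((1ℚ - t) * r k + t * r k')))
  where open Trapezoid T

Intersect : {d : ℕ} → Trapezoid d → Trapezoid d → Set
Intersect T T' = ∃[ p ] (InTrap T p × InTrap T' p)

IsTrapezoidGraph : {n : ℕ} → ℕ → (Fin n → Fin n → Set) → Set
IsTrapezoidGraph {n} d E =
  Σ (Fin n → Trapezoid d) λ T → ∀ u v → E u v ⇔ ((u ≢ v) × Intersect (T u) (T v))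

-- For two letters u ≠ v of a 2d-uniform word, and likewise for two d-trapezoids,
-- call u left of v on line k when there the k-th interval of u ends before that
-- of v begins.  On both sides of the theorem u and v are related exactly when they
-- "meet": on some line neither is left of the other, or which one is left changes
-- between two adjacent lines.  For words, δ_{i,i}(w) ∈ {0101, 1010, 0110, 1001}
-- is the first case on line i, and δ_{i,i}^{2d→4}(w) ∈ {00111100, 11000011} the
-- second on lines i, i+1.  For trapezoids, the first case is an overlap on a line,
-- and in the second the right boundary of one crosses the left boundary of the
-- other inside the strip; conversely, if neither trapezoid is left of the other on
-- all lines, a line or a strip of one of these kinds exists.
-- A word gives trapezoids whose k-th interval runs between the (2k-1)-st and 2k-th
-- occurrence of the letter (letters occurring a wrong number of times are placed
-- far away), and trapezoids give the word listing, line after line, the owners of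
-- the sorted endpoints.
module Submission where

open import Defs
open import Data.Bool using (Bool; true; false; T)
open import Data.Nat using (ℕ; zero; suc)
open import Data.Fin using (Fin; zero; suc; toℕ)
open import Data.List using (List; []; _∷_; _++_; map; concat; tabulate)
open import Data.List.Membership.Propositional using (_∈_)
open import Data.List.Relation.Unary.Any using (here; there)
open import Data.Product using (∃; ∃₂; ∃-syntax; _×_; _,_; proj₁; proj₂)
open import Data.Sum using (_⊎_; inj₁; inj₂; swap)
open import Data.Empty using (⊥; ⊥-elim)
open import Function.Bundles using (_⇔_; mk⇔; Equivalence; _↔_; Inverse; Injection)
open import Function.Properties.Equivalence using () renaming (trans to ⇔-trans; sym to ⇔-sym)
open import Function.Properties.Inverse using (↔⇒↣)
open import Function.Construct.Identity using (↔-id; ⇔-id)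
open import Data.Product.Function.NonDependent.Propositional using (_×-⇔_)
open import Relation.Nullary using (¬_; Dec; yes; no)
open import Relation.Binary.Definitions using (tri<; tri≈; tri>)
open import Relation.Binary.PropositionalEquality

module AdjacentLines where
  open import Data.Fin.Properties using (any?; ¬∀⟶∃¬)
  open import Relation.Nullary using (¬?; _×-dec_)
  open import Relation.Nullary.Decidable using (decidable-stable)

  Adjacent : {d : ℕ} → Fin d → Fin d → Set
  Adjacent k k' = toℕ k' ≡ suc (toℕ k)

  -- P k and Q k stand for "on line k the first object is left of the second"
  -- and "the second is left of the first".
  Meet : {d : ℕ} → (P Q : Fin d → Set) → Set
  Meet P Q = (∃ λ k → ¬ P k × ¬ Q k) ⊎ (∃₂ λ k k' → Adjacent k k' × (P k × Q k' ⊎ Q k × P k'))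

  module _ {d : ℕ} {P Q P' Q' : Fin d → Set} where

    Meet-map : (∀ k → P k ⇔ P' k) → (∀ k → Q k ⇔ Q' k) → Meet P Q → Meet P' Q'
    Meet-map p q (inj₁ (k , ¬Pk , ¬Qk)) =
      inj₁ (k , (λ P'k → ¬Pk (Equivalence.from (p k) P'k)) , (λ Q'k → ¬Qk (Equivalence.from (q k) Q'k)))
    Meet-map p q (inj₂ (k , k' , adj , inj₁ (Pk , Qk'))) =
      inj₂ (k , k' , adj , inj₁ (Equivalence.to (p k) Pk , Equivalence.to (q k') Qk'))
    Meet-map p q (inj₂ (k , k' , adj , inj₂ (Qk , Pk'))) =
      inj₂ (k , k' , adj , inj₂ (Equivalence.to (q k) Qk , Equivalence.to (p k') Pk'))

  P-to-Q-switch : ∀ {d} (P Q : Fin (suc d) → Set) → (∀ k → P k ⊎ Q k) → P zero → ∀ a → ¬ P a →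
                  ∃₂ λ k k' → Adjacent k k' × P k × Q k'
  P-to-Q-switch P Q PQ P0 zero ¬Pa = ⊥-elim (¬Pa P0)
  P-to-Q-switch {suc d} P Q PQ P0 (suc a) ¬Pa with PQ (suc zero)
  ... | inj₂ Q1 = zero , suc zero , refl , P0 , Q1
  ... | inj₁ P1 with P-to-Q-switch (λ k → P (suc k)) (λ k → Q (suc k)) (λ k → PQ (suc k)) P1 a ¬Pa
  ...   | k , k' , adj , Pk , Qk' = suc k , suc k' , cong suc adj , Pk , Qk'

  switch : ∀ {d} {P Q : Fin d → Set} → (∀ k → P k ⊎ Q k) → ∃ (λ a → ¬ P a) → ∃ (λ b → ¬ Q b) →
           ∃₂ λ k k' → Adjacent k k' × (P k × Q k' ⊎ Q k × P k')
  switch {zero} _ (() , _) _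
  switch {suc d} {P} {Q} PQ (a , ¬Pa) (b , ¬Qb) with PQ zero
  ... | inj₁ P0 = let (k , k' , adj , Pk , Qk') = P-to-Q-switch P Q PQ P0 a ¬Pa
                  in k , k' , adj , inj₁ (Pk , Qk')
  ... | inj₂ Q0 = let (k , k' , adj , Qk , Pk') = P-to-Q-switch Q P (λ k → swap (PQ k)) Q0 b ¬Qb
                  in k , k' , adj , inj₂ (Qk , Pk')

  ¬All⇒Meet : ∀ {d} {P Q : Fin d → Set} → (∀ k → Dec (P k)) → (∀ k → Dec (Q k)) →
              ¬ (∀ k → P k) → ¬ (∀ k → Q k) → Meet P Q
  ¬All⇒Meet {d} {P} {Q} P? Q? ¬∀P ¬∀Q with any? (λ k → ¬? (P? k) ×-dec ¬? (Q? k))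
  ... | yes neither = inj₁ neither
  ... | no ¬neither = inj₂ (switch P⊎Q (¬∀⟶∃¬ d P P? ¬∀P) (¬∀⟶∃¬ d Q Q? ¬∀Q))
    where
    P⊎Q : ∀ k → P k ⊎ Q k
    P⊎Q k with P? k
    ... | yes Pk = inj₁ Pk
    ... | no ¬Pk = inj₂ (decidable-stable (Q? k) (λ ¬Qk → ¬neither (k , ¬Pk , ¬Qk)))

open AdjacentLines

module BinaryWords where
  open import Data.Bool using (not; if_then_else_; _∧_)
  open import Data.Bool.Properties using (not-involutive; ∧-zeroʳ)
  open import Data.Nat using (_+_; _*_; _∸_; _⊔_; _<_; _≤_; _≤ᵇ_; z≤n; s≤s; z<s; s<s)
  open import Data.Nat.Properties
  open import Data.List using (replicate)
  open import Data.Fin using (fromℕ<)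
  open import Data.Fin.Properties using (toℕ<n; toℕ-fromℕ<)
  open import Data.Unit using (tt)
  open import Relation.Nullary.Decidable using (dec-true; dec-false)

  flip : BWord → BWord
  flip = map not

  flip-involutive : ∀ w → flip (flip w) ≡ w
  flip-involutive [] = refl
  flip-involutive (b ∷ w) = cong₂ _∷_ (not-involutive b) (flip-involutive w)

  count-flip : ∀ b w → count b (flip w) ≡ count (not b) w
  count-flip b [] = refl
  count-flip false (false ∷ w) = count-flip false w
  count-flip false (true ∷ w) = cong suc (count-flip false w)
  count-flip true (false ∷ w) = cong suc (count-flip true w)
  count-flip true (true ∷ w) = count-flip true w

  count-++ : ∀ b u w → count b (u ++ w) ≡ count b u + count b w
  count-++ b [] w = refl
  count-++ false (false ∷ u) w = cong suc (count-++ false u w)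
  count-++ false (true ∷ u) w = count-++ false u w
  count-++ true (false ∷ u) w = count-++ true u w
  count-++ true (true ∷ u) w = cong suc (count-++ true u w)

  -- Occurrences are counted from 0: the j-th 0 of w comes before its j'-th 1
  -- (also when w has no j'-th 1, but not when it has no j-th 0).
  precedes : BWord → ℕ → ℕ → Bool
  precedes [] j j' = false
  precedes (false ∷ w) zero j' = true
  precedes (false ∷ w) (suc j) j' = precedes w j j'
  precedes (true ∷ w) j zero = false
  precedes (true ∷ w) j (suc j') = precedes w j j'

  precedes-++ˡ : ∀ u w j j' → j < count false u → precedes (u ++ w) j j' ≡ precedes u j j'
  precedes-++ˡ (false ∷ u) w zero j' _ = refl
  precedes-++ˡ (false ∷ u) w (suc j) j' (s≤s j<) = precedes-++ˡ u w j j' j<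
  precedes-++ˡ (true ∷ u) w j zero _ = refl
  precedes-++ˡ (true ∷ u) w j (suc j') j< = precedes-++ˡ u w j j' j<

  precedes-++ʳ : ∀ u w j j' → precedes (u ++ w) (count false u + j) (count true u + j') ≡ precedes w j j'
  precedes-++ʳ [] w j j' = refl
  precedes-++ʳ (false ∷ u) w j j' = precedes-++ʳ u w j j'
  precedes-++ʳ (true ∷ u) w j j' = precedes-++ʳ u w j j'

  window : BWord → ℕ → ℕ → ℕ → ℕ → BWord
  window [] s₀ t₀ s₁ t₁ = []
  window (false ∷ w) (suc s₀) t₀ s₁ t₁ = window w s₀ t₀ s₁ t₁
  window (false ∷ w) zero (suc t₀) s₁ t₁ = false ∷ window w zero t₀ s₁ t₁
  window (false ∷ w) zero zero s₁ t₁ = window w zero zero s₁ t₁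
  window (true ∷ w) s₀ t₀ (suc s₁) t₁ = window w s₀ t₀ s₁ t₁
  window (true ∷ w) s₀ t₀ zero (suc t₁) = true ∷ window w s₀ t₀ zero t₁
  window (true ∷ w) s₀ t₀ zero zero = window w s₀ t₀ zero zero

  flip-window : ∀ w s₀ t₀ s₁ t₁ → flip (window w s₀ t₀ s₁ t₁) ≡ window (flip w) s₁ t₁ s₀ t₀
  flip-window [] s₀ t₀ s₁ t₁ = refl
  flip-window (false ∷ w) (suc s₀) t₀ s₁ t₁ = flip-window w s₀ t₀ s₁ t₁
  flip-window (false ∷ w) zero (suc t₀) s₁ t₁ = cong (true ∷_) (flip-window w zero t₀ s₁ t₁)
  flip-window (false ∷ w) zero zero s₁ t₁ = flip-window w zero zero s₁ t₁
  flip-window (true ∷ w) s₀ t₀ (suc s₁) t₁ = flip-window w s₀ t₀ s₁ t₁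
  flip-window (true ∷ w) s₀ t₀ zero (suc t₁) = cong (false ∷_) (flip-window w s₀ t₀ zero t₁)
  flip-window (true ∷ w) s₀ t₀ zero zero = flip-window w s₀ t₀ zero zero

  count-window : ∀ w s₀ t₀ s₁ t₁ → s₀ + t₀ ≤ count false w → count false (window w s₀ t₀ s₁ t₁) ≡ t₀
  count-window [] zero zero s₁ t₁ _ = refl
  count-window (false ∷ w) (suc s₀) t₀ s₁ t₁ (s≤s le) = count-window w s₀ t₀ s₁ t₁ le
  count-window (false ∷ w) zero (suc t₀) s₁ t₁ (s≤s le) = cong suc (count-window w zero t₀ s₁ t₁ le)
  count-window (false ∷ w) zero zero s₁ t₁ _ = count-window w zero zero s₁ t₁ z≤n
  count-window (true ∷ w) s₀ t₀ (suc s₁) t₁ le = count-window w s₀ t₀ s₁ t₁ le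
  count-window (true ∷ w) s₀ t₀ zero (suc t₁) le = count-window w s₀ t₀ zero t₁ le
  count-window (true ∷ w) s₀ t₀ zero zero le = count-window w s₀ t₀ zero zero le

  precedes-window : ∀ w s₀ t₀ s₁ t₁ j j' → j < t₀ → j' < t₁ →
                    precedes (window w s₀ t₀ s₁ t₁) j j' ≡ precedes w (s₀ + j) (s₁ + j')
  precedes-window [] s₀ t₀ s₁ t₁ j j' _ _ = refl
  precedes-window (false ∷ w) (suc s₀) t₀ s₁ t₁ j j' j< j'< = precedes-window w s₀ t₀ s₁ t₁ j j' j< j'<
  precedes-window (false ∷ w) zero (suc t₀) s₁ t₁ zero j' _ _ = refl
  precedes-window (false ∷ w) zero (suc t₀) s₁ t₁ (suc j) j' (s≤s j<) j'< =
    precedes-window w zero t₀ s₁ t₁ j j' j< j'<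
  precedes-window (true ∷ w) s₀ t₀ (suc s₁) t₁ j j' j< j'< = precedes-window w s₀ t₀ s₁ t₁ j j' j< j'<
  precedes-window (true ∷ w) s₀ t₀ zero (suc t₁) j zero _ _ = refl
  precedes-window (true ∷ w) s₀ t₀ zero (suc t₁) j (suc j') j< (s≤s j'<) =
    precedes-window w s₀ t₀ zero t₁ j j' j< j'<

  module _ (A m : ℕ) where

    private
      kept : ℕ → Bool
      kept c = (suc A ≤ᵇ suc c) ∧ (suc c ≤ᵇ A + m)

      toKeep : ℕ → ℕ
      toKeep c = A + m ∸ (A ⊔ c)

    -- The (c+1)-st occurrence of a letter comes before, inside or after the
    -- range A+1 … A+m kept by keepOcc (suc A) (A + m).
    data Phase (c : ℕ) : Set where
      skipping : kept c ≡ false → A ∸ c ≡ suc (A ∸ suc c) → toKeep (suc c) ≡ toKeep c → Phase c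
      keeping : kept c ≡ true → A ∸ c ≡ 0 → A ∸ suc c ≡ 0 → toKeep c ≡ suc (toKeep (suc c)) → Phase c
      finished : kept c ≡ false → A ∸ c ≡ 0 → A ∸ suc c ≡ 0 → toKeep c ≡ 0 → toKeep (suc c) ≡ 0 → Phase c

    phase : ∀ c → Phase c
    phase c with c <? A
    ... | yes c<A = skipping kept≡false (+-∸-assoc 1 c<A)
                      (cong (A + m ∸_) (trans (m≥n⇒m⊔n≡m c<A) (sym (m≥n⇒m⊔n≡m (<⇒≤ c<A)))))
      where
      kept≡false : kept c ≡ false
      kept≡false rewrite dec-false (suc A ≤? suc c) (<⇒≱ (s≤s c<A)) = refl
    ... | no c≮A with c <? A + m
    ...   | yes c<A+m = keeping kept≡true (m≤n⇒m∸n≡0 A≤c) (m≤n⇒m∸n≡0 (m≤n⇒m≤1+n A≤c)) toKeep-step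
      where
      A≤c : A ≤ c
      A≤c = ≮⇒≥ c≮A
      kept≡true : kept c ≡ true
      kept≡true rewrite dec-true (suc A ≤? suc c) (s≤s A≤c) | dec-true (suc c ≤? A + m) c<A+m = refl
      toKeep-step : toKeep c ≡ suc (toKeep (suc c))
      toKeep-step rewrite m≤n⇒m⊔n≡n A≤c | m≤n⇒m⊔n≡n (m≤n⇒m≤1+n A≤c) = +-∸-assoc 1 c<A+m
    ...   | no c≮A+m = finished kept≡false (m≤n⇒m∸n≡0 A≤c) (m≤n⇒m∸n≡0 (m≤n⇒m≤1+n A≤c))
                         (m≤n⇒m∸n≡0 (≤-trans A+m≤c (m≤n⊔m A c)))
                         (m≤n⇒m∸n≡0 (≤-trans (m≤n⇒m≤1+n A+m≤c) (m≤n⊔m A (suc c))))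
      where
      A≤c : A ≤ c
      A≤c = ≮⇒≥ c≮A
      A+m≤c : A + m ≤ c
      A+m≤c = ≮⇒≥ c≮A+m
      kept≡false : kept c ≡ false
      kept≡false rewrite dec-false (suc c ≤? A + m) c≮A+m = ∧-zeroʳ (suc A ≤ᵇ suc c)

    window-false-step : ∀ w c s₁ t₁ →
      window (false ∷ w) (A ∸ c) (toKeep c) s₁ t₁
        ≡ (if kept c then false ∷ window w (A ∸ suc c) (toKeep (suc c)) s₁ t₁
                     else window w (A ∸ suc c) (toKeep (suc c)) s₁ t₁)
    window-false-step w c s₁ t₁ with phase c
    ... | skipping k s k' rewrite k | s | k' = refl
    ... | keeping k s s' k' rewrite k | s | s' | k' = refl
    ... | finished k s s' k₀ k₀' rewrite k | s | s' | k₀ | k₀' = refl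

    window-true-step : ∀ w s₀ t₀ c →
      window (true ∷ w) s₀ t₀ (A ∸ c) (toKeep c)
        ≡ (if kept c then true ∷ window w s₀ t₀ (A ∸ suc c) (toKeep (suc c))
                     else window w s₀ t₀ (A ∸ suc c) (toKeep (suc c)))
    window-true-step w s₀ t₀ c with phase c
    ... | skipping k s k' rewrite k | s | k' = refl
    ... | keeping k s s' k' rewrite k | s | s' | k' = refl
    ... | finished k s s' k₀ k₀' rewrite k | s | s' | k₀ | k₀' = refl

    keepOccFrom-window : ∀ w c₀ c₁ →
      keepOccFrom (suc A) (A + m) c₀ c₁ w ≡ window w (A ∸ c₀) (toKeep c₀) (A ∸ c₁) (toKeep c₁)
    keepOccFrom-window [] c₀ c₁ = refl
    keepOccFrom-window (false ∷ w) c₀ c₁ =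
      trans (cong (λ v → if kept c₀ then false ∷ v else v) (keepOccFrom-window w (suc c₀) c₁))
            (sym (window-false-step w c₀ (A ∸ c₁) (toKeep c₁)))
    keepOccFrom-window (true ∷ w) c₀ c₁ =
      trans (cong (λ v → if kept c₁ then true ∷ v else v) (keepOccFrom-window w c₀ (suc c₁)))
            (sym (window-true-step w (A ∸ c₀) (toKeep c₀) c₁))

    keepOcc-window : ∀ w → keepOcc (suc A) (A + m) w ≡ window w A m A m
    keepOcc-window w rewrite keepOccFrom-window w 0 0 | ⊔-identityʳ A | m+n∸m≡n A m = refl

  only-zeros : ∀ v → count true v ≡ 0 → v ≡ replicate (count false v) false
  only-zeros [] _ = refl
  only-zeros (false ∷ v) c = cong (false ∷_) (only-zeros v c)

  only-ones : ∀ v → count false v ≡ 0 → v ≡ replicate (count true v) true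
  only-ones [] _ = refl
  only-ones (true ∷ v) c = cong (true ∷_) (only-ones v c)

  one-of-each : ∀ v → count false v ≡ 1 → count true v ≡ 1 →
                v ≡ false ∷ true ∷ [] ⊎ v ≡ true ∷ false ∷ []
  one-of-each (false ∷ v) c₀ c₁ =
    inj₁ (cong (false ∷_) (trans (only-ones v (suc-injective c₀)) (cong (λ n → replicate n true) c₁)))
  one-of-each (true ∷ v) c₀ c₁ =
    inj₂ (cong (true ∷_) (trans (only-zeros v (suc-injective c₁)) (cong (λ n → replicate n false) c₀)))

  patterns2-sound : ∀ v → v ∈ patterns2 → ¬ T (precedes v 1 0) × ¬ T (precedes (flip v) 1 0)
  patterns2-sound _ (here refl) = (λ ()) , (λ ())
  patterns2-sound _ (there (here refl)) = (λ ()) , (λ ())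
  patterns2-sound _ (there (there (here refl))) = (λ ()) , (λ ())
  patterns2-sound _ (there (there (there (here refl)))) = (λ ()) , (λ ())

  patterns2-complete : ∀ v → count false v ≡ 2 → count true v ≡ 2 →
                       ¬ T (precedes v 1 0) → ¬ T (precedes (flip v) 1 0) → v ∈ patterns2
  patterns2-complete (false ∷ false ∷ v) _ _ ¬p _ = ⊥-elim (¬p tt)
  patterns2-complete (true ∷ true ∷ v) _ _ _ ¬q = ⊥-elim (¬q tt)
  patterns2-complete (false ∷ true ∷ v) c₀ c₁ _ _ with one-of-each v (suc-injective c₀) (suc-injective c₁)
  ... | inj₁ refl = here refl
  ... | inj₂ refl = there (there (here refl))
  patterns2-complete (true ∷ false ∷ v) c₀ c₁ _ _ with one-of-each v (suc-injective c₀) (suc-injective c₁)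
  ... | inj₁ refl = there (there (there (here refl)))
  ... | inj₂ refl = there (here refl)

  patterns4-sound : ∀ v → v ∈ patterns4 →
    (T (precedes v 1 0) × T (precedes (flip v) 3 2)) ⊎ (T (precedes (flip v) 1 0) × T (precedes v 3 2))
  patterns4-sound _ (here refl) = inj₁ (tt , tt)
  patterns4-sound _ (there (here refl)) = inj₂ (tt , tt)

  is-00111100 : ∀ v → count false v ≡ 4 → count true v ≡ 4 →
    T (precedes v 1 0) → T (precedes (flip v) 3 2) →
    v ≡ false ∷ false ∷ true ∷ true ∷ true ∷ true ∷ false ∷ false ∷ []
  is-00111100 (false ∷ false ∷ true ∷ true ∷ true ∷ true ∷ v) c₀ c₁ _ _ =
    cong (λ u → false ∷ false ∷ true ∷ true ∷ true ∷ true ∷ u)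
         (trans (only-zeros v (+-cancelˡ-≡ 4 _ 0 c₁)) (cong (λ n → replicate n false) (+-cancelˡ-≡ 2 _ 2 c₀)))
  is-00111100 (true ∷ _) _ _ () _
  is-00111100 (false ∷ true ∷ _) _ _ () _
  is-00111100 (false ∷ false ∷ []) _ _ _ ()
  is-00111100 (false ∷ false ∷ false ∷ _) _ _ _ ()
  is-00111100 (false ∷ false ∷ true ∷ []) _ _ _ ()
  is-00111100 (false ∷ false ∷ true ∷ false ∷ _) _ _ _ ()
  is-00111100 (false ∷ false ∷ true ∷ true ∷ []) _ _ _ ()
  is-00111100 (false ∷ false ∷ true ∷ true ∷ false ∷ _) _ _ _ ()
  is-00111100 (false ∷ false ∷ true ∷ true ∷ true ∷ []) _ _ _ ()
  is-00111100 (false ∷ false ∷ true ∷ true ∷ true ∷ false ∷ _) _ _ _ ()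

  2i+2≡2[1+i] : ∀ i → 2 * i + 2 ≡ 2 * suc i
  2i+2≡2[1+i] i = trans (+-comm (2 * i) 2) (sym (*-suc 2 i))

  window-uniform : ∀ w A m → A + m ≤ count false w → A + m ≤ count true w → Uniform m (window w A m A m)
  window-uniform w A m le₀ le₁ =
    count-window w A m A m le₀ ,
    (begin
      count true (window w A m A m)          ≡⟨ count-flip false (window w A m A m) ⟨
      count false (flip (window w A m A m))  ≡⟨ cong (count false) (flip-window w A m A m) ⟩
      count false (window (flip w) A m A m)  ≡⟨ count-window (flip w) A m A m le₁' ⟩
      m                                      ∎)
    where
    open ≡-Reasoning
    le₁' : A + m ≤ count false (flip w)
    le₁' = subst (A + m ≤_) (sym (count-flip false w)) le₁

  -- On line i (from 0) a letter occupies its occurrences 2i and 2i+1;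
  -- leftAt w i says that there the interval of 0 ends before that of 1 begins.
  leftAt : BWord → ℕ → Bool
  leftAt w i = precedes w (2 * i + 1) (2 * i)

  window-leftAt : ∀ w i m → 1 < m → precedes (window w (2 * i) m (2 * i) m) 1 0 ≡ leftAt w i
  window-leftAt w i m 1<m =
    trans (precedes-window w (2 * i) m (2 * i) m 1 0 1<m (<-trans z<s 1<m))
          (cong (precedes w (2 * i + 1)) (+-identityʳ (2 * i)))

  window-leftAt-suc : ∀ w i m → 3 < m → precedes (window w (2 * i) m (2 * i) m) 3 2 ≡ leftAt w (suc i)
  window-leftAt-suc w i m 3<m =
    trans (precedes-window w (2 * i) m (2 * i) m 3 2 3<m (<-trans (s<s (s<s z<s)) 3<m))
          (cong₂ (precedes w) (trans (sym (+-assoc (2 * i) 2 1)) (cong (_+ 1) (2i+2≡2[1+i] i)))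
                              (2i+2≡2[1+i] i))

  δ-window : ∀ i w → δ (suc i) w ≡ window w (2 * i) 2 (2 * i) 2
  δ-window i w =
    trans (cong₂ (λ a b → keepOcc a b w) (cong (_∸ 1) (*-suc 2 i)) (sym (2i+2≡2[1+i] i)))
          (keepOcc-window (2 * i) 2 w)

  δ4-window : ∀ i w → δ4 (suc i) w ≡ window w (2 * i) 4 (2 * i) 4
  δ4-window i w =
    trans (cong₂ (λ a b → keepOcc a b w) (cong (_∸ 1) (*-suc 2 i))
                                          (trans (cong (_+ 2) (sym (2i+2≡2[1+i] i))) (+-assoc (2 * i) 2 2)))
          (keepOcc-window (2 * i) 4 w)

  patterns2⇔ : ∀ v → Uniform 2 v → v ∈ patterns2 ⇔ (¬ T (precedes v 1 0) × ¬ T (precedes (flip v) 1 0))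
  patterns2⇔ v (c₀ , c₁) = mk⇔ (patterns2-sound v) (λ (¬p , ¬q) → patterns2-complete v c₀ c₁ ¬p ¬q)

  patterns4-complete : ∀ v → Uniform 4 v →
    (T (precedes v 1 0) × T (precedes (flip v) 3 2)) ⊎ (T (precedes (flip v) 1 0) × T (precedes v 3 2)) →
    v ∈ patterns4
  patterns4-complete v (c₀ , c₁) (inj₁ (p , q)) rewrite is-00111100 v c₀ c₁ p q = here refl
  patterns4-complete v (c₀ , c₁) (inj₂ (p , q)) = subst (_∈ patterns4) 11000011≡v (there (here refl))
    where
    flip-v≡ : flip v ≡ false ∷ false ∷ true ∷ true ∷ true ∷ true ∷ false ∷ false ∷ []
    flip-v≡ = is-00111100 (flip v) (trans (count-flip false v) c₁) (trans (count-flip true v) c₀) p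
                (subst (λ u → T (precedes u 3 2)) (sym (flip-involutive v)) q)
    11000011≡v : true ∷ true ∷ false ∷ false ∷ false ∷ false ∷ true ∷ true ∷ [] ≡ v
    11000011≡v = trans (cong flip (sym flip-v≡)) (flip-involutive v)

  patterns4⇔ : ∀ v → Uniform 4 v → v ∈ patterns4 ⇔
    ((T (precedes v 1 0) × T (precedes (flip v) 3 2)) ⊎ (T (precedes (flip v) 1 0) × T (precedes v 3 2)))
  patterns4⇔ v U = mk⇔ (patterns4-sound v) (patterns4-complete v U)

  LeftAt : {d : ℕ} → BWord → Fin d → Set
  LeftAt w k = T (leftAt w (toℕ k))

  double-≤ : ∀ {i n d} → i + n ≤ d → 2 * i + 2 * n ≤ 2 * d
  double-≤ {i} {n} {d} le = subst (_≤ 2 * d) (*-distribˡ-+ 2 i n) (*-monoʳ-≤ 2 le)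

  module _ {d : ℕ} (w : BWord) (U : Uniform (2 * d) w) where

    private
      window-uniform-at : ∀ i m → i + m ≤ d → Uniform (2 * m) (window w (2 * i) (2 * m) (2 * i) (2 * m))
      window-uniform-at i m le =
        window-uniform w (2 * i) (2 * m) (subst (2 * i + 2 * m ≤_) (sym (proj₁ U)) (double-≤ {i} {m} le))
                                         (subst (2 * i + 2 * m ≤_) (sym (proj₂ U)) (double-≤ {i} {m} le))

    δ-patterns2-at : (k : Fin d) → δ (suc (toℕ k)) w ∈ patterns2 ⇔ (¬ LeftAt w k × ¬ LeftAt (flip w) k)
    δ-patterns2-at k
      rewrite δ-window (toℕ k) w
            | sym (window-leftAt w (toℕ k) 2 ≤-refl)
            | sym (window-leftAt (flip w) (toℕ k) 2 ≤-refl)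
            | sym (flip-window w (2 * toℕ k) 2 (2 * toℕ k) 2)
      = patterns2⇔ _ (window-uniform-at (toℕ k) 1 (subst (_≤ d) (+-comm 1 (toℕ k)) (toℕ<n k)))

    δ4-patterns4-at : ∀ {k k'} → Adjacent k k' → δ4 (suc (toℕ k)) w ∈ patterns4 ⇔
      ((LeftAt w k × LeftAt (flip w) k') ⊎ (LeftAt (flip w) k × LeftAt w k'))
    δ4-patterns4-at {k} {k'} adj
      rewrite δ4-window (toℕ k) w
            | adj
            | sym (window-leftAt w (toℕ k) 4 (s<s z<s))
            | sym (window-leftAt (flip w) (toℕ k) 4 (s<s z<s))
            | sym (window-leftAt-suc w (toℕ k) 4 ≤-refl)
            | sym (window-leftAt-suc (flip w) (toℕ k) 4 ≤-refl)
            | sym (flip-window w (2 * toℕ k) 4 (2 * toℕ k) 4)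
      = patterns4⇔ _ (window-uniform-at (toℕ k) 2
                        (subst (_≤ d) (trans (cong suc adj) (+-comm 2 (toℕ k))) (toℕ<n k')))

  line-index : ∀ {d} (R : ℕ → Set) → (∃[ i ] (1 ≤ i × i ≤ d × R i)) ⇔ (∃ λ (k : Fin d) → R (suc (toℕ k)))
  line-index {d} R = mk⇔ to from
    where
    to : ∃[ i ] (1 ≤ i × i ≤ d × R i) → ∃ λ (k : Fin d) → R (suc (toℕ k))
    to (suc i , _ , i<d , r) = fromℕ< i<d , subst (λ j → R (suc j)) (sym (toℕ-fromℕ< i<d)) r
    from : (∃ λ (k : Fin d) → R (suc (toℕ k))) → ∃[ i ] (1 ≤ i × i ≤ d × R i)
    from (k , r) = suc (toℕ k) , s≤s z≤n , toℕ<n k , r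

  <⇒≤∸1 : ∀ {i d} → suc i < d → suc i ≤ d ∸ 1
  <⇒≤∸1 (s≤s i<d) = i<d

  ≤∸1⇒< : ∀ {i d} → suc i ≤ d ∸ 1 → suc i < d
  ≤∸1⇒< {d = suc d} le = s≤s le

  strip-index : ∀ {d} (R : ℕ → Set) →
    (∃[ i ] (1 ≤ i × i ≤ d ∸ 1 × R i)) ⇔ (∃₂ λ (k k' : Fin d) → Adjacent k k' × R (suc (toℕ k)))
  strip-index {d} R = mk⇔ to from
    where
    to : ∃[ i ] (1 ≤ i × i ≤ d ∸ 1 × R i) → ∃₂ λ (k k' : Fin d) → Adjacent k k' × R (suc (toℕ k))
    to (suc i , _ , le , r) =
      fromℕ< i<d , fromℕ< 1+i<d , trans (toℕ-fromℕ< 1+i<d) (cong suc (sym (toℕ-fromℕ< i<d))) ,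
      subst (λ j → R (suc j)) (sym (toℕ-fromℕ< i<d)) r
      where
      1+i<d : suc i < d
      1+i<d = ≤∸1⇒< le
      i<d : i < d
      i<d = <-trans (n<1+n i) 1+i<d
    from : (∃₂ λ (k k' : Fin d) → Adjacent k k' × R (suc (toℕ k))) → ∃[ i ] (1 ≤ i × i ≤ d ∸ 1 × R i)
    from (k , k' , adj , r) = suc (toℕ k) , s≤s z≤n , <⇒≤∸1 (subst (_< d) adj (toℕ<n k')) , r

  Ltrap⇔Meet : ∀ d w → Ltrap d w ⇔ (Uniform (2 * d) w × Meet (LeftAt w) (LeftAt (flip w)))
  Ltrap⇔Meet d w = mk⇔ (λ (U , p) → U , to U p) (λ (U , m) → U , from U m)
    where
    Patterns : Set
    Patterns = (∃[ i ] (1 ≤ i × i ≤ d × δ i w ∈ patterns2)) ⊎ (∃[ i ] (1 ≤ i × i ≤ d ∸ 1 × δ4 i w ∈ patterns4))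

    to : Uniform (2 * d) w → Patterns → Meet (LeftAt w) (LeftAt (flip w))
    to U (inj₁ p) with Equivalence.to (line-index (λ i → δ i w ∈ patterns2)) p
    ... | k , δ∈ = inj₁ (k , Equivalence.to (δ-patterns2-at w U k) δ∈)
    to U (inj₂ p) with Equivalence.to (strip-index (λ i → δ4 i w ∈ patterns4)) p
    ... | k , k' , adj , δ4∈ = inj₂ (k , k' , adj , Equivalence.to (δ4-patterns4-at w U adj) δ4∈)

    from : Uniform (2 * d) w → Meet (LeftAt w) (LeftAt (flip w)) → Patterns
    from U (inj₁ (k , ¬left)) =
      inj₁ (Equivalence.from (line-index (λ i → δ i w ∈ patterns2))
             (k , Equivalence.from (δ-patterns2-at w U k) ¬left))
    from U (inj₂ (k , k' , adj , cross)) =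
      inj₂ (Equivalence.from (strip-index (λ i → δ4 i w ∈ patterns4))
             (k , k' , adj , Equivalence.from (δ4-patterns4-at w U adj) cross))

  count-concat : ∀ {d} b (G : Fin d → BWord) → (∀ k → count b (G k) ≡ 2) → count b (concat (tabulate G)) ≡ 2 * d
  count-concat {zero} b G c = refl
  count-concat {suc d} b G c = begin
    count b (G zero ++ concat (tabulate (λ k → G (suc k))))
      ≡⟨ count-++ b (G zero) _ ⟩
    count b (G zero) + count b (concat (tabulate (λ k → G (suc k))))
      ≡⟨ cong₂ _+_ (c zero) (count-concat b (λ k → G (suc k)) (λ k → c (suc k))) ⟩
    2 + 2 * d
      ≡⟨ *-suc 2 d ⟨
    2 * suc d ∎
    where open ≡-Reasoning

  uniform-concat : ∀ {d} (G : Fin d → BWord) → (∀ k → Uniform 2 (G k)) → Uniform (2 * d) (concat (tabulate G))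
  uniform-concat G U = count-concat false G (λ k → proj₁ (U k)) , count-concat true G (λ k → proj₂ (U k))

  leftAt-concat : ∀ {d} (G : Fin d → BWord) → (∀ k → Uniform 2 (G k)) →
                  ∀ k → leftAt (concat (tabulate G)) (toℕ k) ≡ precedes (G k) 1 0
  leftAt-concat G U zero = precedes-++ˡ (G zero) _ 1 0 (subst (1 <_) (sym (proj₁ (U zero))) (s<s z<s))
  leftAt-concat G U (suc k) = begin
    precedes (G zero ++ rest) (2 * suc i + 1) (2 * suc i)
      ≡⟨ cong₂ (precedes (G zero ++ rest)) zeros ones ⟩
    precedes (G zero ++ rest) (count false (G zero) + (2 * i + 1)) (count true (G zero) + 2 * i)
      ≡⟨ precedes-++ʳ (G zero) rest (2 * i + 1) (2 * i) ⟩
    leftAt rest i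
      ≡⟨ leftAt-concat (λ k → G (suc k)) (λ k → U (suc k)) k ⟩
    precedes (G (suc k)) 1 0 ∎
    where
    open ≡-Reasoning
    i : ℕ
    i = toℕ k
    rest : BWord
    rest = concat (tabulate (λ k → G (suc k)))
    zeros : 2 * suc i + 1 ≡ count false (G zero) + (2 * i + 1)
    zeros = trans (cong (_+ 1) (*-suc 2 i))
                  (trans (+-assoc 2 (2 * i) 1) (cong (_+ (2 * i + 1)) (sym (proj₁ (U zero)))))
    ones : 2 * suc i ≡ count true (G zero) + 2 * i
    ones = trans (*-suc 2 i) (cong (_+ 2 * i) (sym (proj₂ (U zero))))

open BinaryWords

module TrapezoidGeometry where
  open import Data.Nat as ℕ using ()
  import Data.Nat.Properties as ℕ
  open import Data.Nat.Coprimality using (1-coprimeTo) renaming (sym to coprime-sym)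
  open import Data.Integer as ℤ using (+_; +≤+; +<+)
  import Data.Integer.Properties as ℤ
  import Data.Rational as ℚ
  open import Data.Rational using (ℚ; mkℚ; _+_; _*_; _-_; -_; 1/_; _≤_; _<_; 0ℚ; 1ℚ; *≤*; *<*;
    NonZero; Positive; positive; nonNegative)
  open import Data.Rational.Properties
  open import Data.Rational.Solver using (module +-*-Solver)
  open import Data.Fin.Properties using (toℕ-injective)
  open +-*-Solver using (solve; _:+_; _:-_; _:*_; _:=_; con)

  ℕtoℚ≡mkℚ : ∀ n → ℕtoℚ n ≡ mkℚ (+ n) 0 (coprime-sym (1-coprimeTo n))
  ℕtoℚ≡mkℚ n = normalize-coprime (coprime-sym (1-coprimeTo n))

  ℕtoℚ-mono-≤ : ∀ {m n} → m ℕ.≤ n → ℕtoℚ m ≤ ℕtoℚ n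
  ℕtoℚ-mono-≤ {m} {n} m≤n rewrite ℕtoℚ≡mkℚ m | ℕtoℚ≡mkℚ n =
    *≤* (subst₂ ℤ._≤_ (sym (ℤ.*-identityʳ (+ m))) (sym (ℤ.*-identityʳ (+ n))) (+≤+ m≤n))

  ℕtoℚ-mono-< : ∀ {m n} → m ℕ.< n → ℕtoℚ m < ℕtoℚ n
  ℕtoℚ-mono-< {m} {n} m<n rewrite ℕtoℚ≡mkℚ m | ℕtoℚ≡mkℚ n =
    *<* (subst₂ ℤ._<_ (sym (ℤ.*-identityʳ (+ m))) (sym (ℤ.*-identityʳ (+ n))) (+<+ m<n))

  ℕtoℚ-cancel-< : ∀ {m n} → ℕtoℚ m < ℕtoℚ n → m ℕ.< n
  ℕtoℚ-cancel-< {m} {n} lt with m ℕ.<? n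
  ... | yes m<n = m<n
  ... | no m≮n = ⊥-elim (<-irrefl refl (<-≤-trans lt (ℕtoℚ-mono-≤ (ℕ.≮⇒≥ m≮n))))

  <ᵇ⇔ℕtoℚ-< : ∀ m n → T (m ℕ.<ᵇ n) ⇔ ℕtoℚ m < ℕtoℚ n
  <ᵇ⇔ℕtoℚ-< m n = mk⇔ (λ lt → ℕtoℚ-mono-< (ℕ.<ᵇ⇒< m n lt)) (λ lt → ℕ.<⇒<ᵇ (ℕtoℚ-cancel-< {m} {n} lt))

  ℕtoℚ-suc : ∀ n → ℕtoℚ (suc n) ≡ ℕtoℚ n + 1ℚ
  ℕtoℚ-suc n rewrite ℕtoℚ≡mkℚ n =
    cong (λ i → i ℚ./ 1) (sym (trans (cong (ℤ._+ + 1) (ℤ.*-identityʳ (+ n))) (cong +_ (ℕ.+-comm n 1))))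

  ℕtoℚ-injective : ∀ {m n} → ℕtoℚ m ≡ ℕtoℚ n → m ≡ n
  ℕtoℚ-injective {m} {n} eq with ℕ.<-cmp m n
  ... | tri< m<n _ _ = ⊥-elim (<⇒≢ (ℕtoℚ-mono-< m<n) eq)
  ... | tri≈ _ m≡n _ = m≡n
  ... | tri> _ _ n<m = ⊥-elim (<⇒≢ (ℕtoℚ-mono-< n<m) (sym eq))

  0<q-p : ∀ {p q} → p < q → 0ℚ < q - p
  0<q-p {p} {q} p<q = subst (_< q - p) (+-inverseʳ p) (+-monoˡ-< (- p) p<q)

  0≤q-p : ∀ {p q} → p ≤ q → 0ℚ ≤ q - p
  0≤q-p {p} {q} p≤q = subst (_≤ q - p) (+-inverseʳ p) (+-monoˡ-≤ (- p) p≤q)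

  +-cancelˡ-≡ : ∀ a {t t'} → a + t ≡ a + t' → t ≡ t'
  +-cancelˡ-≡ a {t} {t'} eq = trans (a+x-a≡x t) (trans (cong (_- a) eq) (sym (a+x-a≡x t')))
    where
    a+x-a≡x : ∀ x → x ≡ (a + x) - a
    a+x-a≡x = solve 2 (λ a x → x := (a :+ x) :- a) refl a

  height-< : ∀ {m n t t'} → m ℕ.< n → t < 1ℚ → 0ℚ ≤ t' → ℕtoℚ m + t < ℕtoℚ n + t'
  height-< {m} {n} {t} {t'} m<n t<1 0≤t' = begin-strict
    ℕtoℚ m + t    <⟨ +-monoʳ-< (ℕtoℚ m) t<1 ⟩
    ℕtoℚ m + 1ℚ   ≡⟨ ℕtoℚ-suc m ⟨
    ℕtoℚ (suc m)  ≤⟨ ℕtoℚ-mono-≤ m<n ⟩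
    ℕtoℚ n        ≡⟨ +-identityʳ (ℕtoℚ n) ⟨
    ℕtoℚ n + 0ℚ   ≤⟨ +-monoʳ-≤ (ℕtoℚ n) 0≤t' ⟩
    ℕtoℚ n + t'   ∎
    where open ≤-Reasoning

  height-unique : ∀ {m n t t'} → 0ℚ ≤ t → t < 1ℚ → 0ℚ ≤ t' → t' < 1ℚ →
                  ℕtoℚ m + t ≡ ℕtoℚ n + t' → m ≡ n × t ≡ t'
  height-unique {m} {n} 0≤t t<1 0≤t' t'<1 eq with ℕ.<-cmp m n
  ... | tri< m<n _ _ = ⊥-elim (<⇒≢ (height-< m<n t<1 0≤t') eq)
  ... | tri≈ _ refl _ = refl , +-cancelˡ-≡ (ℕtoℚ m) eq
  ... | tri> _ _ n<m = ⊥-elim (<⇒≢ (height-< n<m t'<1 0≤t) (sym eq))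

  not-integral : ∀ {m n t} → 0ℚ < t → t < 1ℚ → ℕtoℚ m ≢ ℕtoℚ n + t
  not-integral {m} {n} 0<t t<1 eq
    with height-unique {m} {n} ≤-refl (positive⁻¹ 1ℚ) (<⇒≤ 0<t) t<1 (trans (+-identityʳ (ℕtoℚ m)) eq)
  ... | _ , 0≡t = <⇒≢ 0<t 0≡t

  lerp : ℚ → ℚ → ℚ → ℚ
  lerp t a b = (1ℚ - t) * a + t * b

  lerp-0 : ∀ {t} a b → t ≡ 0ℚ → lerp t a b ≡ a
  lerp-0 a b refl = solve 2 (λ a b → (con 1ℚ :- con 0ℚ) :* a :+ con 0ℚ :* b := a) refl a b

  lerp-1 : ∀ {t} a b → t ≡ 1ℚ → lerp t a b ≡ b
  lerp-1 a b refl = solve 2 (λ a b → (con 1ℚ :- con 1ℚ) :* a :+ con 1ℚ :* b := b) refl a b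

  lerp-mono-≤ : ∀ {t a a' b b'} → 0ℚ ≤ t → t ≤ 1ℚ → a ≤ a' → b ≤ b' → lerp t a b ≤ lerp t a' b'
  lerp-mono-≤ {t} 0≤t t≤1 a≤a' b≤b' =
    +-mono-≤ (*-monoˡ-≤-nonNeg (1ℚ - t) {{nonNegative (0≤q-p t≤1)}} a≤a')
             (*-monoˡ-≤-nonNeg t {{nonNegative 0≤t}} b≤b')

  lerp-mono-< : ∀ {t a a' b b'} → 0ℚ ≤ t → t < 1ℚ → a < a' → b ≤ b' → lerp t a b < lerp t a' b'
  lerp-mono-< {t} 0≤t t<1 a<a' b≤b' =
    +-mono-<-≤ (*-monoʳ-<-pos (1ℚ - t) {{positive (0<q-p t<1)}} a<a')
               (*-monoˡ-≤-nonNeg t {{nonNegative 0≤t}} b≤b')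

  0≤q-p⇒p≤q : ∀ {p q} → 0ℚ ≤ q - p → p ≤ q
  0≤q-p⇒p≤q {p} {q} 0≤q-p = subst₂ _≤_ (+-identityˡ p) (q-p+p≡q q p) (+-monoˡ-≤ p 0≤q-p)
    where
    q-p+p≡q : ∀ q p → (q - p) + p ≡ q
    q-p+p≡q = solve 2 (λ q p → (q :- p) :+ p := q) refl

  crossing-point : ∀ r r' l l' → r < l → l' < r' → ∃ λ t → 0ℚ ≤ t × t ≤ 1ℚ × lerp t r r' ≡ lerp t l l'
  crossing-point r r' l l' r<l l'<r' = t , <⇒≤ 0<t , t≤1 , lerp-equal
    where
    a b : ℚ
    a = l - r
    b = r' - l'
    instance
      a-pos : Positive a
      a-pos = positive (0<q-p r<l)
      b-pos : Positive b
      b-pos = positive (0<q-p l'<r')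
      a+b-pos : Positive (a + b)
      a+b-pos = pos+pos⇒pos a b
      a+b-nonZero : NonZero (a + b)
      a+b-nonZero = pos⇒nonZero (a + b)
      s-pos : Positive (1/ (a + b))
      s-pos = 1/pos⇒pos (a + b)
    s t : ℚ
    s = 1/ (a + b)
    t = a * s
    1-t≡b*s : 1ℚ - t ≡ b * s
    1-t≡b*s = trans (cong (_- t) (sym (*-inverseʳ (a + b))))
                    (solve 3 (λ a b s → (a :+ b) :* s :- a :* s := b :* s) refl a b s)
    0<t : 0ℚ < t
    0<t = positive⁻¹ t {{pos*pos⇒pos a s}}
    t≤1 : t ≤ 1ℚ
    t≤1 = 0≤q-p⇒p≤q (subst (0ℚ ≤_) (sym 1-t≡b*s) (<⇒≤ (positive⁻¹ (b * s) {{pos*pos⇒pos b s}})))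
    lerp-equal : lerp t r r' ≡ lerp t l l'
    lerp-equal = begin
      (1ℚ - t) * r + t * r'  ≡⟨ cong (λ u → u * r + t * r') 1-t≡b*s ⟩
      (b * s) * r + t * r'   ≡⟨ solve 5 (λ r r' l l' s → ((r' :- l') :* s) :* r :+ ((l :- r) :* s) :* r'
                                                      := ((r' :- l') :* s) :* l :+ ((l :- r) :* s) :* l')
                                       refl r r' l l' s ⟩
      (b * s) * l + t * l'   ≡⟨ cong (λ u → u * l + t * l') 1-t≡b*s ⟨
      (1ℚ - t) * l + t * l'  ∎
      where open ≡-Reasoning

  module _ {d : ℕ} where
    open Trapezoid

    LeftOn : Trapezoid d → Trapezoid d → Fin d → Set
    LeftOn T T' k = r T k < ℓ T' k

    LeftOf : Trapezoid d → Trapezoid d → Set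
    LeftOf T T' = ∀ k → LeftOn T T' k

    Intersect-sym : ∀ {T T' : Trapezoid d} → Intersect T T' → Intersect T' T
    Intersect-sym (p , inT , inT') = p , inT' , inT

    -- InTrap with 0 < t < 1 on strips, so that the height of a point determines
    -- its line, or its strip and t.
    data Locus (T : Trapezoid d) (x y : ℚ) : Set where
      on-line : ∀ k → y ≡ ℕtoℚ (toℕ k) → ℓ T k ≤ x → x ≤ r T k → Locus T x y
      in-strip : ∀ {k k'} t → Adjacent k k' → 0ℚ < t → t < 1ℚ → y ≡ ℕtoℚ (toℕ k) + t →
                 lerp t (ℓ T k) (ℓ T k') ≤ x → x ≤ lerp t (r T k) (r T k') → Locus T x y

    locus : ∀ T {x y} → InTrap T (x , y) → Locus T x y
    locus T (inj₁ (k , y≡ , ℓ≤x , x≤r)) = on-line k y≡ ℓ≤x x≤r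
    locus T {x} {y} (inj₂ (k , k' , t , adj , 0≤t , t≤1 , y≡ , lo , hi)) with 0ℚ <? t | t <? 1ℚ
    ... | yes 0<t | yes t<1 = in-strip t adj 0<t t<1 y≡ lo hi
    ... | no 0≮t | _ =
      on-line k (trans y≡ (trans (cong (λ u → ℕtoℚ (toℕ k) + u) t≡0) (+-identityʳ _)))
                (subst (_≤ x) (lerp-0 (ℓ T k) (ℓ T k') t≡0) lo)
                (subst (x ≤_) (lerp-0 (r T k) (r T k') t≡0) hi)
      where
      t≡0 : t ≡ 0ℚ
      t≡0 = ≤-antisym (≮⇒≥ 0≮t) 0≤t
    ... | yes _ | no t≮1 =
      on-line k' y≡k' (subst (_≤ x) (lerp-1 (ℓ T k) (ℓ T k') t≡1) lo)
                      (subst (x ≤_) (lerp-1 (r T k) (r T k') t≡1) hi)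
      where
      t≡1 : t ≡ 1ℚ
      t≡1 = ≤-antisym t≤1 (≮⇒≥ t≮1)
      y≡k' : y ≡ ℕtoℚ (toℕ k')
      y≡k' = begin
        y                        ≡⟨ y≡ ⟩
        ℕtoℚ (toℕ k) + t         ≡⟨ cong (λ u → ℕtoℚ (toℕ k) + u) t≡1 ⟩
        ℕtoℚ (toℕ k) + 1ℚ        ≡⟨ ℕtoℚ-suc (toℕ k) ⟨
        ℕtoℚ (suc (toℕ k))       ≡⟨ cong ℕtoℚ adj ⟨
        ℕtoℚ (toℕ k')            ∎
        where open ≡-Reasoning

    LeftOf⇒¬Intersect : ∀ {T T'} → LeftOf T T' → ¬ Intersect T T'
    LeftOf⇒¬Intersect {T} {T'} left ((x , y) , inT , inT') = separated (locus T inT) (locus T' inT')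
      where
      separated : Locus T x y → Locus T' x y → ⊥
      separated (on-line k y≡ _ x≤r) (on-line k₂ y≡₂ ℓ≤x _)
        with toℕ-injective {i = k} {j = k₂} (ℕtoℚ-injective (trans (sym y≡) y≡₂))
      ... | refl = <-irrefl refl (≤-<-trans x≤r (<-≤-trans (left k) ℓ≤x))
      separated (on-line k y≡ _ _) (in-strip {k₂} t _ 0<t t<1 y≡₂ _ _) =
        not-integral {toℕ k} {toℕ k₂} 0<t t<1 (trans (sym y≡) y≡₂)
      separated (in-strip {k} t _ 0<t t<1 y≡ _ _) (on-line k₂ y≡₂ _ _) =
        not-integral {toℕ k₂} {toℕ k} 0<t t<1 (trans (sym y≡₂) y≡)
      separated (in-strip {k} {k'} t adj 0<t t<1 y≡ _ x≤r) (in-strip {k₂} {k₂'} t₂ adj₂ 0<t₂ t₂<1 y≡₂ ℓ≤x _)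
        with height-unique (<⇒≤ 0<t) t<1 (<⇒≤ 0<t₂) t₂<1 (trans (sym y≡) y≡₂)
      ... | k≡k₂ , refl with toℕ-injective {i = k} {j = k₂} k≡k₂
      ...   | refl with toℕ-injective {i = k'} {j = k₂'} (trans adj (sym adj₂))
      ...     | refl =
        <-irrefl refl (≤-<-trans x≤r (<-≤-trans (lerp-mono-< (<⇒≤ 0<t) t<1 (left k) (<⇒≤ (left k'))) ℓ≤x))

    overlap-on-line : ∀ {T T'} k → ¬ LeftOn T T' k → ¬ LeftOn T' T k → Intersect T T'
    overlap-on-line {T} {T'} k ¬left ¬left' with ≤-total (ℓ T k) (ℓ T' k)
    ... | inj₁ ℓ≤ℓ' = (ℓ T' k , ℕtoℚ (toℕ k)) ,
                      inj₁ (k , refl , ℓ≤ℓ' , ≮⇒≥ ¬left) , inj₁ (k , refl , ≤-refl , ℓ≤r T' k)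
    ... | inj₂ ℓ'≤ℓ = (ℓ T k , ℕtoℚ (toℕ k)) ,
                      inj₁ (k , refl , ≤-refl , ℓ≤r T k) , inj₁ (k , refl , ℓ'≤ℓ , ≮⇒≥ ¬left')

    -- The common point is where the right boundary of T meets the left boundary of T'.
    crossing-in-strip : ∀ {T T' k k'} → Adjacent k k' → LeftOn T T' k → LeftOn T' T k' → Intersect T T'
    crossing-in-strip {T} {T'} {k} {k'} adj left left' =
      common-point (crossing-point (r T k) (r T k') (ℓ T' k) (ℓ T' k') left
                                   (≤-<-trans (ℓ≤r T' k') (<-≤-trans left' (ℓ≤r T k'))))
      where
      below-right : ∀ T {t} → 0ℚ ≤ t → t ≤ 1ℚ → lerp t (ℓ T k) (ℓ T k') ≤ lerp t (r T k) (r T k')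
      below-right T 0≤t t≤1 = lerp-mono-≤ 0≤t t≤1 (ℓ≤r T k) (ℓ≤r T k')
      common-point : (∃ λ t → 0ℚ ≤ t × t ≤ 1ℚ × lerp t (r T k) (r T k') ≡ lerp t (ℓ T' k) (ℓ T' k')) →
                     Intersect T T'
      common-point (t , 0≤t , t≤1 , crossing) =
        (lerp t (r T k) (r T k') , ℕtoℚ (toℕ k) + t) ,
        inj₂ (k , k' , t , adj , 0≤t , t≤1 , refl , below-right T 0≤t t≤1 , ≤-refl) ,
        inj₂ (k , k' , t , adj , 0≤t , t≤1 , refl , ≤-reflexive (sym crossing) ,
              subst (_≤ lerp t (r T' k) (r T' k')) (sym crossing) (below-right T' 0≤t t≤1))

    Intersect⇔Meet : ∀ {T T'} → Intersect T T' ⇔ Meet (LeftOn T T') (LeftOn T' T)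
    Intersect⇔Meet {T} {T'} = mk⇔ to from
      where
      to : Intersect T T' → Meet (LeftOn T T') (LeftOn T' T)
      to I = ¬All⇒Meet (λ k → r T k <? ℓ T' k) (λ k → r T' k <? ℓ T k)
                       (λ left → LeftOf⇒¬Intersect {T} {T'} left I)
                       (λ left → LeftOf⇒¬Intersect {T'} {T} left (Intersect-sym {T} {T'} I))
      from : Meet (LeftOn T T') (LeftOn T' T) → Intersect T T'
      from (inj₁ (k , ¬left , ¬left')) = overlap-on-line {T} {T'} k ¬left ¬left'
      from (inj₂ (k , k' , adj , inj₁ (left , left'))) = crossing-in-strip {T} {T'} adj left left'
      from (inj₂ (k , k' , adj , inj₂ (left' , left))) =
        Intersect-sym {T'} {T} (crossing-in-strip {T'} {T} adj left' left)

  Ltrap⇔Intersect : ∀ {d} {T T' : Trapezoid d} w → Uniform (2 ℕ.* d) w →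
                    (∀ k → LeftAt w k ⇔ LeftOn T T' k) → (∀ k → LeftAt (flip w) k ⇔ LeftOn T' T k) →
                    Ltrap d w ⇔ Intersect T T'
  Ltrap⇔Intersect {d} {T} {T'} w U left left' = ⇔-trans (Ltrap⇔Meet d w) (mk⇔ to from)
    where
    to : Uniform (2 ℕ.* d) w × Meet (LeftAt w) (LeftAt (flip w)) → Intersect T T'
    to (_ , meet) = Equivalence.from (Intersect⇔Meet {T = T} {T'}) (Meet-map left left' meet)
    from : Intersect T T' → Uniform (2 ℕ.* d) w × Meet (LeftAt w) (LeftAt (flip w))
    from I = U , Meet-map (λ k → ⇔-sym (left k)) (λ k → ⇔-sym (left' k))
                          (Equivalence.to (Intersect⇔Meet {T = T} {T'}) I)

open TrapezoidGeometry

module Projections where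
  open import Data.Fin as Fin using ()
  open import Data.List using (length; filter)
  import Data.List.Properties as List
  open import Relation.Nullary using (_⊎-dec_)

  module _ {m : ℕ} where

    multiplicity : Fin m → List (Fin m) → ℕ
    multiplicity a w = length (filter (Fin._≟ a) w)

    count-h : ∀ {u v : Fin m} (w : List (Fin m)) → u ≢ v → count false (h u v w) ≡ multiplicity u w
    count-h [] _ = refl
    count-h {u} {v} (x ∷ w) u≢v with x Fin.≟ u | x Fin.≟ v
    ... | yes _ | _ = cong suc (count-h w u≢v)
    ... | no _ | yes _ = count-h w u≢v
    ... | no _ | no _ = count-h w u≢v

    flip-h : ∀ {u v : Fin m} (w : List (Fin m)) → u ≢ v → flip (h u v w) ≡ h v u w
    flip-h [] _ = refl
    flip-h {u} {v} (x ∷ w) u≢v with x Fin.≟ u | x Fin.≟ v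
    ... | yes refl | yes refl = ⊥-elim (u≢v refl)
    ... | yes _ | no _ = cong (true ∷_) (flip-h w u≢v)
    ... | no _ | yes _ = cong (false ∷_) (flip-h w u≢v)
    ... | no _ | no _ = flip-h w u≢v

    count-true-h : ∀ {u v : Fin m} (w : List (Fin m)) → u ≢ v → count true (h u v w) ≡ multiplicity v w
    count-true-h {u} {v} w u≢v = begin
      count true (h u v w)          ≡⟨ count-flip false (h u v w) ⟨
      count false (flip (h u v w))  ≡⟨ cong (count false) (flip-h w u≢v) ⟩
      count false (h v u w)         ≡⟨ count-h w (λ v≡u → u≢v (sym v≡u)) ⟩
      multiplicity v w              ∎
      where open ≡-Reasoning

  module _ {m : ℕ} (u v : Fin m) where

    h-++ : ∀ xs ys → h u v (xs ++ ys) ≡ h u v xs ++ h u v ys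
    h-++ [] ys = refl
    h-++ (x ∷ xs) ys with x Fin.≟ u | x Fin.≟ v
    ... | yes _ | _ = cong (false ∷_) (h-++ xs ys)
    ... | no _ | yes _ = cong (true ∷_) (h-++ xs ys)
    ... | no _ | no _ = h-++ xs ys

    h-concat : ∀ xss → h u v (concat xss) ≡ concat (map (h u v) xss)
    h-concat [] = refl
    h-concat (xs ∷ xss) = trans (h-++ xs (concat xss)) (cong (h u v xs ++_) (h-concat xss))

    IsUV? : (x : Fin m) → Dec (x ≡ u ⊎ x ≡ v)
    IsUV? x = (x Fin.≟ u) ⊎-dec (x Fin.≟ v)

    h-∷ : ∀ x {xs ys} → h u v xs ≡ h u v ys → h u v (x ∷ xs) ≡ h u v (x ∷ ys)
    h-∷ x eq with x Fin.≟ u | x Fin.≟ v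
    ... | yes _ | _ = cong (false ∷_) eq
    ... | no _ | yes _ = cong (true ∷_) eq
    ... | no _ | no _ = eq

    h-other : ∀ x {xs} → ¬ (x ≡ u ⊎ x ≡ v) → h u v (x ∷ xs) ≡ h u v xs
    h-other x ¬uv with x Fin.≟ u | x Fin.≟ v
    ... | yes x≡u | _ = ⊥-elim (¬uv (inj₁ x≡u))
    ... | no _ | yes x≡v = ⊥-elim (¬uv (inj₂ x≡v))
    ... | no _ | no _ = refl

    h-filter : ∀ {E : Set} (f : E → Fin m) xs → h u v (map f xs) ≡ h u v (map f (filter (λ e → IsUV? (f e)) xs))
    h-filter f [] = refl
    h-filter f (e ∷ xs) with IsUV? (f e)
    ... | yes uv = trans (h-∷ (f e) (h-filter f xs))
                         (cong (λ ys → h u v (map f ys)) (sym (List.filter-accept (λ e → IsUV? (f e)) uv)))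
    ... | no ¬uv = trans (h-other (f e) ¬uv) (trans (h-filter f xs)
                         (cong (λ ys → h u v (map f ys)) (sym (List.filter-reject (λ e → IsUV? (f e)) ¬uv))))

    select : Bool → Fin m
    select false = u
    select true = v

    h-select : u ≢ v → ∀ bs → h u v (map select bs) ≡ bs
    h-select u≢v [] = refl
    h-select u≢v (false ∷ bs) with u Fin.≟ u
    ... | yes _ = cong (false ∷_) (h-select u≢v bs)
    ... | no u≢u = ⊥-elim (u≢u refl)
    h-select u≢v (true ∷ bs) with v Fin.≟ u | v Fin.≟ v
    ... | yes v≡u | _ = ⊥-elim (u≢v (sym v≡u))
    ... | no _ | yes _ = cong (true ∷_) (h-select u≢v bs)
    ... | no _ | no v≢v = ⊥-elim (v≢v refl)

open Projections

module WordToTrapezoids where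
  open import Data.Nat as ℕ using (_+_; _*_; _<ᵇ_)
  import Data.Nat.Properties as ℕ
  open import Data.Fin as Fin using ()
  import Data.Fin.Properties as Fin
  open import Data.List using (length)
  open import Data.Rational using (ℚ)
  import Data.Rational.Properties as ℚ

  module _ {m : ℕ} where

    -- The position (from 0) in w of the j-th occurrence (from 0) of a,
    -- and length w if there is none.
    position : Fin m → ℕ → List (Fin m) → ℕ
    position a j [] = 0
    position a j (x ∷ w) with x Fin.≟ a | j
    ... | yes _ | zero = 0
    ... | yes _ | suc j' = suc (position a j' w)
    ... | no _ | _ = suc (position a j w)

    precedes-h : ∀ {u v : Fin m} (w : List (Fin m)) j j' → u ≢ v →
                 precedes (h u v w) j j' ≡ (position u j w <ᵇ position v j' w)
    precedes-h [] j j' _ = refl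
    precedes-h {u} {v} (x ∷ w) j j' u≢v with x Fin.≟ u | x Fin.≟ v | j | j'
    ... | yes refl | yes refl | _ | _ = ⊥-elim (u≢v refl)
    ... | yes _ | no _ | zero | _ = refl
    ... | yes _ | no _ | suc i | i' = precedes-h w i i' u≢v
    ... | no _ | yes _ | _ | zero = refl
    ... | no _ | yes _ | i | suc i' = precedes-h w i i' u≢v
    ... | no _ | no _ | i | i' = precedes-h w i i' u≢v

    position-mono : ∀ a j (w : List (Fin m)) → position a j w ℕ.≤ position a (suc j) w
    position-mono a j [] = ℕ.z≤n
    position-mono a j (x ∷ w) with x Fin.≟ a | j
    ... | yes _ | zero = ℕ.z≤n
    ... | yes _ | suc i = ℕ.s≤s (position-mono a i w)
    ... | no _ | i = ℕ.s≤s (position-mono a i w)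

    position≤length : ∀ a j (w : List (Fin m)) → position a j w ℕ.≤ length w
    position≤length a j [] = ℕ.z≤n
    position≤length a j (x ∷ w) with x Fin.≟ a | j
    ... | yes _ | zero = ℕ.z≤n
    ... | yes _ | suc i = ℕ.s≤s (position≤length a i w)
    ... | no _ | i = ℕ.s≤s (position≤length a i w)

  module WordTrapezoids {m : ℕ} (d : ℕ) (w : List (Fin m)) where
    open Trapezoid

    span : Fin m → Trapezoid d
    span a = record
      { ℓ = λ k → ℕtoℚ (position a (2 * toℕ k) w)
      ; r = λ k → ℕtoℚ (position a (2 * toℕ k + 1) w)
      ; ℓ≤r = λ k → ℕtoℚ-mono-≤ (subst (λ j → position a (2 * toℕ k) w ℕ.≤ position a j w)
                                        (ℕ.+-comm 1 (2 * toℕ k)) (position-mono a (2 * toℕ k) w))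
      }

    -- A vertical segment to the right of every position in w, at an abscissa
    -- that differs from letter to letter.
    remote : Fin m → Trapezoid d
    remote a = record { ℓ = λ _ → x ; r = λ _ → x ; ℓ≤r = λ _ → ℚ.≤-refl }
      where
      x : ℚ
      x = ℕtoℚ (length w + suc (toℕ a))

    Full : Fin m → Set
    Full a = multiplicity a w ≡ 2 * d

    trapezoid : (a : Fin m) → Dec (Full a) → Trapezoid d
    trapezoid a (yes _) = span a
    trapezoid a (no _) = remote a

    trapezoidOf : Fin m → Trapezoid d
    trapezoidOf a = trapezoid a (multiplicity a w ℕ.≟ 2 * d)

    LeftAt-h⇔LeftOn : ∀ {a b} → a ≢ b → ∀ k → LeftAt (h a b w) k ⇔ LeftOn (span a) (span b) k
    LeftAt-h⇔LeftOn {a} {b} a≢b k rewrite precedes-h w (2 * toℕ k + 1) (2 * toℕ k) a≢b =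
      <ᵇ⇔ℕtoℚ-< (position a (2 * toℕ k + 1) w) (position b (2 * toℕ k) w)

    span-left-of-remote : ∀ a b → LeftOf (span b) (remote a)
    span-left-of-remote a b k = ℕtoℚ-mono-< {position b (2 * toℕ k + 1) w}
      (ℕ.≤-<-trans (position≤length b (2 * toℕ k + 1) w) (ℕ.m<m+n (length w) ℕ.z<s))

    remote-left-of-remote : ∀ {a b} → toℕ a ℕ.< toℕ b → LeftOf (remote a) (remote b)
    remote-left-of-remote {a} lt k =
      ℕtoℚ-mono-< {length w + suc (toℕ a)} (ℕ.+-monoʳ-< (length w) (ℕ.s<s lt))

    remote-apart : ∀ {a b} → a ≢ b → (b? : Dec (Full b)) → ¬ Intersect (remote a) (trapezoid b b?)
    remote-apart {a} {b} a≢b (yes _) I =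
      LeftOf⇒¬Intersect {T = span b} {remote a} (span-left-of-remote a b) (Intersect-sym {T = remote a} {span b} I)
    remote-apart {a} {b} a≢b (no _) I with ℕ.<-cmp (toℕ a) (toℕ b)
    ... | tri< a<b _ _ = LeftOf⇒¬Intersect {T = remote a} {remote b} (remote-left-of-remote a<b) I
    ... | tri≈ _ a≡b _ = a≢b (Fin.toℕ-injective a≡b)
    ... | tri> _ _ b<a = LeftOf⇒¬Intersect {T = remote b} {remote a} (remote-left-of-remote b<a)
                                           (Intersect-sym {T = remote a} {remote b} I)

    Ltrap⇔Intersect-letters : ∀ {a b} → a ≢ b → (a? : Dec (Full a)) (b? : Dec (Full b)) →
                              Ltrap d (h a b w) ⇔ Intersect (trapezoid a a?) (trapezoid b b?)
    Ltrap⇔Intersect-letters {a} {b} a≢b (yes full-a) (yes full-b) =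
      Ltrap⇔Intersect {T = span a} {span b} (h a b w)
        (trans (count-h w a≢b) full-a , trans (count-true-h w a≢b) full-b)
        (LeftAt-h⇔LeftOn a≢b)
        (λ k → subst (λ v → LeftAt v k ⇔ LeftOn (span b) (span a) k) (sym (flip-h w a≢b)) (LeftAt-h⇔LeftOn b≢a k))
      where
      b≢a : b ≢ a
      b≢a b≡a = a≢b (sym b≡a)
    Ltrap⇔Intersect-letters {a} {b} a≢b (no ¬full-a) b? =
      mk⇔ (λ L → ⊥-elim (¬full-a (trans (sym (count-h w a≢b)) (proj₁ (proj₁ L)))))
          (λ I → ⊥-elim (remote-apart a≢b b? I))
    Ltrap⇔Intersect-letters {a} {b} a≢b a?@(yes _) (no ¬full-b) =
      mk⇔ (λ L → ⊥-elim (¬full-b (trans (sym (count-true-h w a≢b)) (proj₂ (proj₁ L)))))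
          (λ I → ⊥-elim (remote-apart (λ b≡a → a≢b (sym b≡a)) a? (Intersect-sym {T = span a} {remote b} I)))

    Ltrap⇔Intersect-word : ∀ {a b} → a ≢ b → Ltrap d (h a b w) ⇔ Intersect (trapezoidOf a) (trapezoidOf b)
    Ltrap⇔Intersect-word {a} {b} a≢b =
      Ltrap⇔Intersect-letters a≢b (multiplicity a w ℕ.≟ 2 * d) (multiplicity b w ℕ.≟ 2 * d)

open WordToTrapezoids

module TrapezoidsToWord where
  open import Data.Bool using (f≤t)
  import Data.Bool.Properties as Bool
  open import Data.Nat as ℕ using (_*_)
  open import Data.Fin as Fin using ()
  import Data.Fin.Properties as Fin
  open import Data.Rational using (ℚ; _≤_; _<_)
  import Data.Rational.Properties as ℚ
  open import Data.List using (filter; concatMap; allFin)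
  import Data.List.Properties as List
  import Data.List.Membership.Propositional.Properties as ∈
  open import Data.List.Relation.Unary.All as All using (All; []; _∷_)
  import Data.List.Relation.Unary.All.Properties as All
  open import Data.List.Relation.Unary.AllPairs using ([]; _∷_)
  open import Data.List.Relation.Unary.Unique.Propositional using (Unique)
  import Data.List.Relation.Unary.Unique.Propositional.Properties as Unique
  open import Data.List.Relation.Unary.Linked using ([]; [-]; _∷_)
  open import Data.List.Relation.Binary.Permutation.Propositional
    using (_↭_; ↭-refl; ↭-sym; ↭-trans; ↭-prep; ↭-swap; ↭-reflexive; ↭⇒↭ₛ′)
  import Data.List.Relation.Binary.Permutation.Propositional.Properties as ↭
  open import Data.List.Relation.Binary.Pointwise as Pointwise using (Pointwise-≡⇒≡)
  open import Data.Product.Relation.Binary.Pointwise.NonDependent using (≡×≡⇒≡)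
  open import Data.Product.Relation.Binary.Lex.NonStrict using (×-decTotalOrder)
  open import Relation.Nullary using (_⊎-dec_)
  open import Relation.Binary.Bundles using (DecTotalOrder; TotalOrder)

  all-other : ∀ {A : Set} {u v : A} {ys} → All (λ y → y ≡ u ⊎ y ≡ v) ys → All (u ≢_) ys → All (_≡ v) ys
  all-other [] [] = []
  all-other (inj₁ y≡u ∷ _) (u≢y ∷ _) = ⊥-elim (u≢y (sym y≡u))
  all-other (inj₂ y≡v ∷ uv) (_ ∷ u≢) = y≡v ∷ all-other uv u≢

  unique-singleton : ∀ {A : Set} {v : A} {ys} → Unique ys → All (_≡ v) ys → v ∈ ys → ys ≡ v ∷ []
  unique-singleton {ys = y ∷ []} _ (y≡v ∷ []) _ = cong (_∷ []) y≡v
  unique-singleton {ys = y ∷ y' ∷ _} ((y≢y' ∷ _) ∷ _) (y≡v ∷ y'≡v ∷ _) _ = ⊥-elim (y≢y' (trans y≡v (sym y'≡v)))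

  unique-pair : ∀ {A : Set} {u v : A} {xs} → u ≢ v → Unique xs → All (λ x → x ≡ u ⊎ x ≡ v) xs →
                u ∈ xs → v ∈ xs → xs ≡ u ∷ v ∷ [] ⊎ xs ≡ v ∷ u ∷ []
  unique-pair u≢v (_ ∷ _) (inj₁ refl ∷ _) _ (here v≡u) = ⊥-elim (u≢v (sym v≡u))
  unique-pair {u = u} u≢v (u≢ ∷ unique) (inj₁ refl ∷ uv) _ (there v∈) =
    inj₁ (cong (u ∷_) (unique-singleton unique (all-other uv u≢) v∈))
  unique-pair u≢v (_ ∷ _) (inj₂ refl ∷ _) (here u≡v) _ = ⊥-elim (u≢v u≡v)
  unique-pair {v = v} u≢v (v≢ ∷ unique) (inj₂ refl ∷ uv) (there u∈) _ =
    inj₂ (cong (v ∷_) (unique-singleton unique (all-other (All.map swap uv) v≢) u∈))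

  module TrapezoidWord {n d : ℕ} (trap : Fin n → Trapezoid d) where
    open Trapezoid

    Endpoint : Set
    Endpoint = ℚ × Bool × Fin n

    -- Endpoints are ordered by coordinate, then left (false) before right (true),
    -- so that intervals which merely touch are read as overlapping; the vertex
    -- only breaks the remaining ties.
    endpointOrder : DecTotalOrder _ _ _
    endpointOrder =
      ×-decTotalOrder ℚ.≤-decTotalOrder (×-decTotalOrder Bool.≤-decTotalOrder (Fin.≤-decTotalOrder n))

    open DecTotalOrder endpointOrder using (totalOrder) renaming (_≤_ to _≼_; total to ≼-total)
    open import Data.List.Sort endpointOrder using (sort; sort-↭; sort-↗)
    open import Data.List.Relation.Unary.Sorted.TotalOrder totalOrder using (Sorted)
    import Data.List.Relation.Unary.Sorted.TotalOrder.Properties as Sorted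

    vertex : Endpoint → Fin n
    vertex (_ , _ , u) = u

    leftEnd rightEnd : Fin d → Fin n → Endpoint
    leftEnd k u = ℓ (trap u) k , false , u
    rightEnd k u = r (trap u) k , true , u

    endpointsOf : Fin d → Fin n → List Endpoint
    endpointsOf k u = leftEnd k u ∷ rightEnd k u ∷ []

    endpoints : Fin d → List Endpoint
    endpoints k = concatMap (endpointsOf k) (allFin n)

    lineWord : Fin d → List (Fin n)
    lineWord k = map vertex (sort (endpoints k))

    word : List (Fin n)
    word = concat (tabulate lineWord)

    left≼right : ∀ {a b} u v → a ≤ b → (a , false , u) ≼ (b , true , v)
    left≼right {a} {b} u v a≤b with a ℚ.≟ b
    ... | yes a≡b = inj₂ (a≡b , inj₁ (f≤t , λ ()))
    ... | no a≢b = inj₁ (a≤b , a≢b)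

    right≼left : ∀ {a b} u v → a < b → (a , true , u) ≼ (b , false , v)
    right≼left u v a<b = inj₁ (ℚ.<⇒≤ a<b , ℚ.<⇒≢ a<b)

    ∈-lineWord : ∀ k u → u ∈ lineWord k
    ∈-lineWord k u =
      ∈.∈-map⁺ vertex (↭.∈-resp-↭ (↭-sym (sort-↭ (endpoints k))) (leftEnd∈ (allFin n) (∈.∈-allFin u)))
      where
      leftEnd∈ : ∀ us → u ∈ us → leftEnd k u ∈ concatMap (endpointsOf k) us
      leftEnd∈ (_ ∷ us) (here refl) = here refl
      leftEnd∈ (_ ∷ us) (there u∈) = there (there (leftEnd∈ us u∈))

    module _ {u v : Fin n} (u≢v : u ≢ v) (k : Fin d) where

      Lu Ru Lv Rv : Endpoint
      Lu = leftEnd k u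
      Ru = rightEnd k u
      Lv = leftEnd k v
      Rv = rightEnd k v

      IsUV-endpoint? : (e : Endpoint) → Dec (vertex e ≡ u ⊎ vertex e ≡ v)
      IsUV-endpoint? e = IsUV? u v (vertex e)

      filter-concatMap : ∀ us → filter IsUV-endpoint? (concatMap (endpointsOf k) us)
                                ≡ concatMap (endpointsOf k) (filter (IsUV? u v) us)
      filter-concatMap [] = refl
      filter-concatMap (x ∷ us) with IsUV? u v x
      ... | yes uv = begin
        filter IsUV-endpoint? (leftEnd k x ∷ rightEnd k x ∷ concatMap (endpointsOf k) us)
          ≡⟨ List.filter-accept IsUV-endpoint? {leftEnd k x} uv ⟩
        leftEnd k x ∷ filter IsUV-endpoint? (rightEnd k x ∷ concatMap (endpointsOf k) us)
          ≡⟨ cong (leftEnd k x ∷_) (List.filter-accept IsUV-endpoint? {rightEnd k x} uv) ⟩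
        endpointsOf k x ++ filter IsUV-endpoint? (concatMap (endpointsOf k) us)
          ≡⟨ cong (endpointsOf k x ++_) (filter-concatMap us) ⟩
        concatMap (endpointsOf k) (x ∷ filter (IsUV? u v) us)
          ≡⟨ cong (concatMap (endpointsOf k)) (List.filter-accept (IsUV? u v) uv) ⟨
        concatMap (endpointsOf k) (filter (IsUV? u v) (x ∷ us)) ∎
        where open ≡-Reasoning
      ... | no ¬uv = begin
        filter IsUV-endpoint? (leftEnd k x ∷ rightEnd k x ∷ concatMap (endpointsOf k) us)
          ≡⟨ List.filter-reject IsUV-endpoint? {leftEnd k x} ¬uv ⟩
        filter IsUV-endpoint? (rightEnd k x ∷ concatMap (endpointsOf k) us)
          ≡⟨ List.filter-reject IsUV-endpoint? {rightEnd k x} ¬uv ⟩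
        filter IsUV-endpoint? (concatMap (endpointsOf k) us)
          ≡⟨ filter-concatMap us ⟩
        concatMap (endpointsOf k) (filter (IsUV? u v) us)
          ≡⟨ cong (concatMap (endpointsOf k)) (List.filter-reject (IsUV? u v) ¬uv) ⟨
        concatMap (endpointsOf k) (filter (IsUV? u v) (x ∷ us)) ∎
        where open ≡-Reasoning

      filter-endpoints : filter IsUV-endpoint? (endpoints k) ↭ Lu ∷ Ru ∷ Lv ∷ Rv ∷ []
      filter-endpoints with unique-pair u≢v (Unique.filter⁺ (IsUV? u v) (Unique.allFin⁺ n))
                                            (All.all-filter (IsUV? u v) (allFin n))
                                            (∈.∈-filter⁺ (IsUV? u v) (∈.∈-allFin u) (inj₁ refl))
                                            (∈.∈-filter⁺ (IsUV? u v) (∈.∈-allFin v) (inj₂ refl))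
      ... | inj₁ uv = ↭-reflexive (trans (filter-concatMap (allFin n)) (cong (concatMap (endpointsOf k)) uv))
      ... | inj₂ vu =
        ↭-trans (↭-reflexive (trans (filter-concatMap (allFin n)) (cong (concatMap (endpointsOf k)) vu)))
                (↭.++-comm (Lv ∷ Rv ∷ []) (Lu ∷ Ru ∷ []))

      -- Sorted permutations are unique, so any sorted arrangement of the four
      -- endpoints of u and v is the order in which they appear on line k.
      h-lineWord : ∀ X → Sorted X → X ↭ Lu ∷ Ru ∷ Lv ∷ Rv ∷ [] → h u v (lineWord k) ≡ h u v (map vertex X)
      h-lineWord X X↗ X↭ =
        trans (h-filter u v vertex (sort (endpoints k))) (cong (λ Y → h u v (map vertex Y)) filtered≡X)
        where
        filtered↭X : filter IsUV-endpoint? (sort (endpoints k)) ↭ X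
        filtered↭X = ↭-trans (↭.filter-↭ IsUV-endpoint? (sort-↭ (endpoints k)))
                             (↭-trans filter-endpoints (↭-sym X↭))
        filtered≡X : filter IsUV-endpoint? (sort (endpoints k)) ≡ X
        filtered≡X = Pointwise-≡⇒≡ (Pointwise.map (λ (e₁ , e₂) → ≡×≡⇒≡ (e₁ , ≡×≡⇒≡ e₂))
          (Sorted.↗↭↗⇒≋ totalOrder (Sorted.filter⁺ totalOrder IsUV-endpoint? (sort-↗ (endpoints k))) X↗
            (↭⇒↭ₛ′ (TotalOrder.Eq.isEquivalence totalOrder) filtered↭X)))

      LineReading : BWord → Set
      LineReading b = Uniform 2 b × (T (precedes b 1 0) ⇔ LeftOn (trap u) (trap v) k)

      reading : ∀ X bs → Sorted X → X ↭ Lu ∷ Ru ∷ Lv ∷ Rv ∷ [] → map vertex X ≡ map (select u v) bs →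
                LineReading bs → LineReading (h u v (lineWord k))
      reading X bs X↗ X↭ vertices =
        subst LineReading (sym (trans (h-lineWord X X↗ X↭) (trans (cong (h u v) vertices) (h-select u v u≢v bs))))

      line-reading : LineReading (h u v (lineWord k))
      line-reading with r (trap u) k ℚ.<? ℓ (trap v) k | r (trap v) k ℚ.<? ℓ (trap u) k
      ... | yes u<v | _ =
        reading (Lu ∷ Ru ∷ Lv ∷ Rv ∷ []) (false ∷ false ∷ true ∷ true ∷ [])
          (left≼right u u (ℓ≤r (trap u) k) ∷ right≼left u v u<v ∷ left≼right v v (ℓ≤r (trap v) k) ∷ [-])
          ↭-refl refl ((refl , refl) , mk⇔ (λ _ → u<v) _)
      ... | no ¬u<v | yes v<u =
        reading (Lv ∷ Rv ∷ Lu ∷ Ru ∷ []) (true ∷ true ∷ false ∷ false ∷ [])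
          (left≼right v v (ℓ≤r (trap v) k) ∷ right≼left v u v<u ∷ left≼right u u (ℓ≤r (trap u) k) ∷ [-])
          (↭.++-comm (Lv ∷ Rv ∷ []) (Lu ∷ Ru ∷ []))
          refl ((refl , refl) , mk⇔ (λ ()) ¬u<v)
      ... | no ¬u<v | no ¬v<u with ≼-total Lu Lv | ≼-total Ru Rv
      ...   | inj₁ Lu≼Lv | inj₁ Ru≼Rv =
        reading (Lu ∷ Lv ∷ Ru ∷ Rv ∷ []) (false ∷ true ∷ false ∷ true ∷ [])
          (Lu≼Lv ∷ left≼right v u (ℚ.≮⇒≥ ¬u<v) ∷ Ru≼Rv ∷ [-])
          (↭-prep Lu (↭-swap Lv Ru ↭-refl))
          refl ((refl , refl) , mk⇔ (λ ()) ¬u<v)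
      ...   | inj₁ Lu≼Lv | inj₂ Rv≼Ru =
        reading (Lu ∷ Lv ∷ Rv ∷ Ru ∷ []) (false ∷ true ∷ true ∷ false ∷ [])
          (Lu≼Lv ∷ left≼right v v (ℓ≤r (trap v) k) ∷ Rv≼Ru ∷ [-])
          (↭-prep Lu (↭-trans (↭-prep Lv (↭-swap Rv Ru ↭-refl)) (↭-swap Lv Ru ↭-refl)))
          refl ((refl , refl) , mk⇔ (λ ()) ¬u<v)
      ...   | inj₂ Lv≼Lu | inj₁ Ru≼Rv =
        reading (Lv ∷ Lu ∷ Ru ∷ Rv ∷ []) (true ∷ false ∷ false ∷ true ∷ [])
          (Lv≼Lu ∷ left≼right u u (ℓ≤r (trap u) k) ∷ Ru≼Rv ∷ [-])
          (↭-trans (↭-swap Lv Lu ↭-refl) (↭-prep Lu (↭-swap Lv Ru ↭-refl)))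
          refl ((refl , refl) , mk⇔ (λ ()) ¬u<v)
      ...   | inj₂ Lv≼Lu | inj₂ Rv≼Ru =
        reading (Lv ∷ Lu ∷ Rv ∷ Ru ∷ []) (true ∷ false ∷ true ∷ false ∷ [])
          (Lv≼Lu ∷ left≼right u v (ℚ.≮⇒≥ ¬v<u) ∷ Rv≼Ru ∷ [-])
          (↭-trans (↭-swap Lv Lu ↭-refl)
                   (↭-prep Lu (↭-trans (↭-prep Lv (↭-swap Rv Ru ↭-refl)) (↭-swap Lv Ru ↭-refl))))
          refl ((refl , refl) , mk⇔ (λ ()) ¬u<v)

    h-word : ∀ u v → h u v word ≡ concat (tabulate (λ k → h u v (lineWord k)))
    h-word u v = trans (h-concat u v (tabulate lineWord)) (cong concat (List.map-tabulate lineWord (h u v)))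

    module _ {u v : Fin n} (u≢v : u ≢ v) where

      uniform-word : Uniform (2 * d) (h u v word)
      uniform-word =
        subst (Uniform (2 * d)) (sym (h-word u v)) (uniform-concat _ (λ k → proj₁ (line-reading u≢v k)))

      LeftAt-word : ∀ k → LeftAt (h u v word) k ⇔ LeftOn (trap u) (trap v) k
      LeftAt-word k = subst (λ b → T b ⇔ LeftOn (trap u) (trap v) k) (sym leftAt≡) (proj₂ (line-reading u≢v k))
        where
        leftAt≡ : leftAt (h u v word) (toℕ k) ≡ precedes (h u v (lineWord k)) 1 0
        leftAt≡ = trans (cong (λ w → leftAt w (toℕ k)) (h-word u v))
                        (leftAt-concat _ (λ k → proj₁ (line-reading u≢v k)) k)

    Ltrap⇔Intersect-vertices : ∀ {u v} → u ≢ v → Ltrap d (h u v word) ⇔ Intersect (trap u) (trap v)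
    Ltrap⇔Intersect-vertices {u} {v} u≢v =
      Ltrap⇔Intersect {T = trap u} {trap v} (h u v word) (uniform-word u≢v) (LeftAt-word u≢v)
        (λ k → subst (λ w → LeftAt w k ⇔ LeftOn (trap v) (trap u) k) (sym (flip-h word u≢v)) (LeftAt-word v≢u k))
      where
      v≢u : v ≢ u
      v≢u v≡u = u≢v (sym v≡u)

    ∈-word : 1 ℕ.≤ d → ∀ u → u ∈ word
    ∈-word (ℕ.s≤s ℕ.z≤n) u = ∈.∈-++⁺ˡ (∈-lineWord zero u)

open TrapezoidsToWord

open import Data.Nat using (_≤_)

↔-≢ : ∀ {A B : Set} (σ : A ↔ B) {u v} → (Inverse.to σ u ≢ Inverse.to σ v) ⇔ (u ≢ v)
↔-≢ σ = mk⇔ (λ σu≢σv u≡v → σu≢σv (cong (Inverse.to σ) u≡v))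
            (λ u≢v σu≡σv → u≢v (Injection.injective (↔⇒↣ σ) σu≡σv))

GL-Ltrap⇔Intersect : ∀ {n d} (w : List (Fin n)) (T : Fin n → Trapezoid d) →
  (∀ {u v} → u ≢ v → Ltrap d (h u v w) ⇔ Intersect (T u) (T v)) →
  ∀ u v → GL (Ltrap d) w u v ⇔ (u ≢ v × Intersect (T u) (T v))
GL-Ltrap⇔Intersect w T pair u v =
  mk⇔ (λ (u≢v , L) → u≢v , Equivalence.to (pair u≢v) L) (λ (u≢v , I) → u≢v , Equivalence.from (pair u≢v) I)

InClass⇒Trapezoid : ∀ {n} d (E : Fin n → Fin n → Set) → InClassGL (Ltrap d) E → IsTrapezoidGraph d E
InClass⇒Trapezoid d E (m , w , _ , σ , E⇔GL) = (λ u → trapezoidOf (to u)) , E⇔Intersect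
  where
  open Inverse σ using (to)
  open WordTrapezoids d w using (trapezoidOf; Ltrap⇔Intersect-word)
  E⇔Intersect : ∀ u v → E u v ⇔ (u ≢ v × Intersect (trapezoidOf (to u)) (trapezoidOf (to v)))
  E⇔Intersect u v =
    ⇔-trans (E⇔GL u v)
            (⇔-trans (GL-Ltrap⇔Intersect w trapezoidOf Ltrap⇔Intersect-word (to u) (to v)) (↔-≢ σ ×-⇔ ⇔-id _))

Trapezoid⇒InClass : ∀ {n d} (E : Fin n → Fin n → Set) → 1 ≤ d → IsTrapezoidGraph d E → InClassGL (Ltrap d) E
Trapezoid⇒InClass {n} {d} E 1≤d (T , E⇔Intersect) =
  n , word , ∈-word 1≤d , ↔-id (Fin n) ,
  λ u v → ⇔-trans (E⇔Intersect u v) (⇔-sym (GL-Ltrap⇔Intersect word T Ltrap⇔Intersect-vertices u v))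
  where
  open TrapezoidWord T using (word; ∈-word; Ltrap⇔Intersect-vertices)

theorem8 : (d : ℕ) → 1 ≤ d →
    ((w : BWord) → Ltrap d w → Uniform (2 Data.Nat.* d) w)
    × ((n : ℕ) (E : Fin n → Fin n → Set) → SimpleGraph E →
    (InClassGL (Ltrap d) E ⇔ IsTrapezoidGraph d E))
theorem8 d 1≤d = (λ w L → proj₁ L) , λ n E _ → mk⇔ (InClass⇒Trapezoid d E) (Trapezoid⇒InClass E 1≤d)
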